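{- Let there be $n$ candidates, candidate $i$ having value $v_i\ge 0$ and acceptance probability $p_i\in[0,1]$. Let $\mathcal{T}$ be a finite rooted tree in which each node $u$ is labeled by a candidate $\mathrm{cand}(u)$ and has at most two children, an "accept" child and a "reject" child, such that the labels along any root-to-leaf path are distinct. Let $\pi_{\mathcal{T}}$ be the distribution over root-to-leaf paths obtained by starting at the root and, at each node $u$ with $i=\mathrm{cand}(u)$, independently recording the outcome "accept" with probability $p_i$ and "reject" otherwise, moving to the corresponding child, and stopping when that child does not exist. For a sampled path $P$ (a sequence of nodes with outcomes), split $P$ into consecutive segments $S_1,\dots,S_\ell$ by ending a segment immediately after each node whose outcome is "accept" (the last segment may end with a "reject" node). For a segment $S$ whose candidates, sorted in non-increasing order of value, are $c_1,\dots,c_m$, let \[\mathrm{segval}(S)=\sum_{r=1}^{m} p_{c_r}v_{c_r}\prod_{r'<r}(1-p_{c_{r'}}).\] Let $\mathrm{val}(\mathcal{T})=\mathbb{E}_{P\sim\pi_{\mathcal{T}}}\big[\sum_{u\in P:\ \text{outcome of }u\text{ is accept}} v_{\mathrm{cand}(u)}\big]$. Then \[\mathbb{E}_{P\sim\pi_{\mathcal{T}}}\Big[\sum_{j=1}^{\ell}\mathrm{segval}(S_j)\Big]\ \ge\ \tfrac12\,\mathrm{val}(\mathcal{T}).\]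
   Context: Such a tree represents an adaptive offer strategy for hiring: each node is an offer, and the two children are the continuations if the offer is accepted or rejected. $\mathrm{segval}(S)$ is the expected value of the highest-valued accepting candidate in $S$ when candidates accept independently with their probabilities (0 if none accepts).
   Formalization: The values $v_i$ and the acceptance probabilities $p_i$ are rational. -}

module Defs where

open import Data.Nat using (ℕ)
open import Data.Fin using (Fin)
open import Data.Bool using (Bool; true; false; if_then_else_)
open import Data.Maybe using (Maybe; nothing; just)
open import Data.Product using (_×_; _,_; proj₁; proj₂)
open import Data.List using (List; []; _∷_; _++_; map)
open import Data.List.Membership.Propositional using (_∉_)
open import Data.Unit using (⊤)
open import Relation.Nullary using (does)
open import Data.Rational using (ℚ; 0ℚ; 1ℚ; _+_; _*_; _-_; _≤_)
open import Data.Rational.Properties using (_≤?_)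

-- An offer tree: every node is labelled by a candidate and has an optional
-- "accept" child and an optional "reject" child.
data Tree (n : ℕ) : Set where
  node : Fin n → Maybe (Tree n) → Maybe (Tree n) → Tree n

mutual
  DistinctFrom : {n : ℕ} → List (Fin n) → Tree n → Set
  DistinctFrom anc (node c a r) =
    (c ∉ anc) × DistinctFromM (c ∷ anc) a × DistinctFromM (c ∷ anc) r

  DistinctFromM : {n : ℕ} → List (Fin n) → Maybe (Tree n) → Set
  DistinctFromM anc nothing  = ⊤
  DistinctFromM anc (just t) = DistinctFrom anc t

DistinctLabels : {n : ℕ} → Tree n → Set
DistinctLabels t = DistinctFrom [] t

-- A sampled path: the sequence of visited candidates with their outcomes
-- (true = accept, false = reject).
Path : ℕ → Set
Path n = List (Fin n × Bool)

-- The distribution π_T as a finite list of (path, probability) pairs.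
module _ {n : ℕ} (p : Fin n → ℚ) where

  prepend : Fin n × Bool → ℚ → Path n × ℚ → Path n × ℚ
  prepend o q (P , w) = (o ∷ P , q * w)

  mutual
    paths : Tree n → List (Path n × ℚ)
    paths (node c a r) =
      map (prepend (c , true) (p c)) (pathsM a)
      ++ map (prepend (c , false) (1ℚ - p c)) (pathsM r)

    pathsM : Maybe (Tree n) → List (Path n × ℚ)
    pathsM nothing  = ([] , 1ℚ) ∷ []
    pathsM (just t) = paths t

  expect : Tree n → (Path n → ℚ) → ℚ
  expect t f = go (paths t)
    where
      go : List (Path n × ℚ) → ℚ
      go [] = 0ℚ
      go ((P , w) ∷ rest) = w * f P + go rest

segments : {n : ℕ} → Path n → List (List (Fin n))
segments [] = []
segments ((c , true) ∷ rest) = (c ∷ []) ∷ segments rest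
segments ((c , false) ∷ rest) with segments rest
... | []       = (c ∷ []) ∷ []
... | (s ∷ ss) = (c ∷ s) ∷ ss

module _ {n : ℕ} (v p : Fin n → ℚ) where

  insertDesc : Fin n → List (Fin n) → List (Fin n)
  insertDesc c [] = c ∷ []
  insertDesc c (d ∷ ds) =
    if does (v d ≤? v c) then c ∷ d ∷ ds else d ∷ insertDesc c ds

  sortDesc : List (Fin n) → List (Fin n)
  sortDesc [] = []
  sortDesc (c ∷ cs) = insertDesc c (sortDesc cs)

  -- Σ_r p_{c_r} v_{c_r} Π_{r'<r} (1 - p_{c_{r'}}), with acc = the running product
  segsum : ℚ → List (Fin n) → ℚ
  segsum acc [] = 0ℚ
  segsum acc (c ∷ cs) = acc * p c * v c + segsum (acc * (1ℚ - p c)) cs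

  segval : List (Fin n) → ℚ
  segval S = segsum 1ℚ (sortDesc S)

  sumSegvals : Path n → ℚ
  sumSegvals P = go (segments P)
    where
      go : List (List (Fin n)) → ℚ
      go [] = 0ℚ
      go (S ∷ Ss) = segval S + go Ss

  acceptedValue : Path n → ℚ
  acceptedValue [] = 0ℚ
  acceptedValue ((c , true) ∷ rest) = v c + acceptedValue rest
  acceptedValue ((c , false) ∷ rest) = acceptedValue rest

  val : Tree n → ℚ
  val t = expect p t acceptedValue

{-# OPTIONS --safe #-}
module Submission where

-- Induct on the tree while carrying the open segment R, the candidates rejected since
-- the last acceptance. The invariant is
--   ½·E[accepted value] + ½·segval R ≤ E[sum of segvals of the path continued after R],
-- and at a node offering c its induction step is the inequality
--   p_c v_c + segval R ≤ (1 + p_c)·segval (R ++ [c]).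
-- To see the latter, sort R ++ [c] and let a be the probability that every candidate
-- above c rejects. The candidates above c have values ≥ v_c, so they contribute at
-- least (1 − a)·v_c to segval R; those below c have values ≤ v_c and lose the factor
-- 1 − p_c.

open import Defs
open import Data.Nat using (ℕ)
open import Data.Fin using (Fin)
open import Data.Rational using (ℚ; 0ℚ; 1ℚ; ½; _+_; _*_; _-_; -_; _≤_; nonNegative)
open import Data.Rational.Properties
open import Data.Rational.Solver using (module +-*-Solver)
open import Data.Bool using (true; false; if_then_else_)
open import Data.Maybe using (Maybe; nothing; just)
open import Data.Product using (_×_; _,_)
open import Data.List using (List; []; _∷_; _++_; map; foldr)
open import Data.List.Properties using (foldr-universal; ++-identityʳ; ++-assoc; map-++)
open import Data.List.Relation.Unary.All as All using (All; []; _∷_)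
open import Function using (_∘_)
open import Relation.Nullary using (Dec; yes; no; does; ¬_; contradiction)
open import Relation.Binary.PropositionalEquality

open +-*-Solver using (solve; _:+_; _:*_; _:-_; _:=_; con)

private
  variable
    n : ℕ

0≤p+q : ∀ {p q} → 0ℚ ≤ p → 0ℚ ≤ q → 0ℚ ≤ p + q
0≤p+q {p} {q} 0≤p 0≤q = subst (_≤ p + q) (+-identityˡ 0ℚ) (+-mono-≤ 0≤p 0≤q)

0≤p*q : ∀ {p q} → 0ℚ ≤ p → 0ℚ ≤ q → 0ℚ ≤ p * q
0≤p*q {p} {q} 0≤p 0≤q =
  nonNegative⁻¹ (p * q)
    {{nonNeg*nonNeg⇒nonNeg p {{nonNegative 0≤p}} q {{nonNegative 0≤q}}}}

p≤q⇒0≤q-p : ∀ {p q} → p ≤ q → 0ℚ ≤ q - p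
p≤q⇒0≤q-p {p} {q} p≤q = subst (_≤ q - p) (+-inverseʳ p) (+-monoˡ-≤ (- p) p≤q)

≤-by-difference : ∀ {p q} d → q - p ≡ d → 0ℚ ≤ d → p ≤ q
≤-by-difference {p} {q} d q-p≡d 0≤d = begin
  p            ≡⟨ +-identityʳ p ⟨
  p + 0ℚ       ≤⟨ +-monoʳ-≤ p 0≤d ⟩
  p + d        ≡⟨ cong (p +_) q-p≡d ⟨
  p + (q - p)  ≡⟨ solve 2 (λ p q → p :+ (q :- p) := q) refl p q ⟩
  q            ∎
  where open ≤-Reasoning

-- 'Defs' branches with 'if does (x ≤? y)'; since ℚ's '_≤?_' unfolds, a 'with' on it
-- cannot abstract the goal, so the case split goes through these eliminators.
if-does-elim : ∀ {P A : Set} {x y : A} (B : A → Set) (P? : Dec P) →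
  (P → B x) → (¬ P → B y) → B (if does P? then x else y)
if-does-elim B (yes p) on-yes on-no = on-yes p
if-does-elim B (no ¬p) on-yes on-no = on-no ¬p

if-does-elim₂ : ∀ {P A : Set} {x y x′ y′ : A} (B : A → A → Set) (P? : Dec P) →
  (P → B x x′) → (¬ P → B y y′) →
  B (if does P? then x else y) (if does P? then x′ else y′)
if-does-elim₂ B (yes p) on-yes on-no = on-yes p
if-does-elim₂ B (no ¬p) on-yes on-no = on-no ¬p

module _ (p : Fin n → ℚ) where

  weightedSum : (Path n → ℚ) → List (Path n × ℚ) → ℚ
  weightedSum f = foldr (λ (P , w) s → w * f P + s) 0ℚ

  -- The meta for the local fold of 'expect' must be created before 'paths p t' is
  -- abstracted, so that pattern unification can solve it.
  expect≡weightedSum : ∀ t f → expect p t f ≡ weightedSum f (paths p t)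
  expect≡weightedSum t f with foldr-universal _ _ _ refl (λ _ _ → refl)
  ... | universal with paths p t
  ... | L = universal L

  weightedSum-++ : ∀ f A B → weightedSum f (A ++ B) ≡ weightedSum f A + weightedSum f B
  weightedSum-++ f [] B = sym (+-identityˡ _)
  weightedSum-++ f ((P , w) ∷ A) B =
    trans (cong (w * f P +_) (weightedSum-++ f A B)) (sym (+-assoc (w * f P) _ _))

  weightedSum-prepend : ∀ f o q L →
    weightedSum f (map (prepend p o q) L) ≡ q * weightedSum (f ∘ (o ∷_)) L
  weightedSum-prepend f o q [] = sym (*-zeroʳ q)
  weightedSum-prepend f o q ((P , w) ∷ L) =
    trans (cong (q * w * f (o ∷ P) +_) (weightedSum-prepend f o q L))
          (solve 4 (λ q w x s → q :* w :* x :+ q :* s := q :* (w :* x :+ s))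
                 refl q w (f (o ∷ P)) (weightedSum (f ∘ (o ∷_)) L))

  weightedSum-cong : ∀ {f g} → f ≗ g → weightedSum f ≗ weightedSum g
  weightedSum-cong f≗g [] = refl
  weightedSum-cong f≗g ((P , w) ∷ L) =
    cong₂ (λ x s → w * x + s) (f≗g P) (weightedSum-cong f≗g L)

  expectM : Maybe (Tree n) → (Path n → ℚ) → ℚ
  expectM m f = weightedSum f (pathsM p m)

  expectM-node : ∀ c a r f →
    expectM (just (node c a r)) f
      ≡ p c * expectM a (f ∘ ((c , true) ∷_))
        + (1ℚ - p c) * expectM r (f ∘ ((c , false) ∷_))
  expectM-node c a r f =
    trans (weightedSum-++ f (map (prepend p (c , true) (p c)) (pathsM p a)) _)
          (cong₂ _+_ (weightedSum-prepend f (c , true) (p c) (pathsM p a))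
                     (weightedSum-prepend f (c , false) (1ℚ - p c) (pathsM p r)))

  expectM-const+ : ∀ m k f → expectM m (λ P → k + f P) ≡ k + expectM m f
  expectM-const+ nothing k f =
    solve 2 (λ k x → con 1ℚ :* (k :+ x) :+ con 0ℚ := k :+ (con 1ℚ :* x :+ con 0ℚ))
            refl k (f [])
  expectM-const+ (just (node c a r)) k f = begin
    expectM (just (node c a r)) (λ P → k + f P)
      ≡⟨ expectM-node c a r _ ⟩
    p c * expectM a (λ P → k + fa P) + (1ℚ - p c) * expectM r (λ P → k + fr P)
      ≡⟨ cong₂ (λ x y → p c * x + (1ℚ - p c) * y)
               (expectM-const+ a k fa) (expectM-const+ r k fr) ⟩
    p c * (k + expectM a fa) + (1ℚ - p c) * (k + expectM r fr)
      ≡⟨ solve 4 (λ pc k x y → pc :* (k :+ x) :+ (con 1ℚ :- pc) :* (k :+ y)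
                                := k :+ (pc :* x :+ (con 1ℚ :- pc) :* y))
               refl (p c) k (expectM a fa) (expectM r fr) ⟩
    k + (p c * expectM a fa + (1ℚ - p c) * expectM r fr)
      ≡⟨ cong (k +_) (expectM-node c a r f) ⟨
    k + expectM (just (node c a r)) f ∎
    where
    open ≡-Reasoning
    fa fr : Path n → ℚ
    fa = f ∘ ((c , true) ∷_)
    fr = f ∘ ((c , false) ∷_)

rejections : List (Fin n) → Path n
rejections = map (_, false)

segments-rejections : ∀ (c : Fin n) R → segments (rejections (c ∷ R)) ≡ (c ∷ R) ∷ []
segments-rejections c [] = refl
segments-rejections c (d ∷ R) rewrite segments-rejections d R = refl

segments-rejections-accept : ∀ R (c : Fin n) P →
  segments (rejections R ++ (c , true) ∷ P) ≡ (R ++ c ∷ []) ∷ segments P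
segments-rejections-accept [] c P = refl
segments-rejections-accept (d ∷ R) c P rewrite segments-rejections-accept R c P = refl

data Insertion (v : Fin n → ℚ) (c : Fin n) : List (Fin n) → List (Fin n) → Set where
  here  : ∀ {X} → All (λ e → v e ≤ v c) X → Insertion v c X (c ∷ X)
  there : ∀ {d X Y} → v c ≤ v d → Insertion v c X Y → Insertion v c (d ∷ X) (d ∷ Y)

module _ (v p : Fin n → ℚ) where

  insertDesc-top : ∀ {c X} → All (λ e → v e ≤ v c) X → insertDesc v p c X ≡ c ∷ X
  insertDesc-top [] = refl
  insertDesc-top {c} {d ∷ X} (d≤c ∷ _) =
    if-does-elim (_≡ c ∷ d ∷ X) (v d ≤? v c) (λ _ → refl) (contradiction d≤c)

  All-insertDesc : ∀ {P : Fin n → Set} {c} X → P c → All P X → All P (insertDesc v p c X)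
  All-insertDesc []      Pc []         = Pc ∷ []
  All-insertDesc {P} {c} (d ∷ X) Pc (Pd ∷ PX) =
    if-does-elim (All P) (v d ≤? v c)
      (λ _ → Pc ∷ Pd ∷ PX)
      (λ _ → Pd ∷ All-insertDesc X Pc PX)

  Insertion-insertDesc : ∀ {c X Y} d → Insertion v c X Y →
    Insertion v c (insertDesc v p d X) (insertDesc v p d Y)
  Insertion-insertDesc {c} {X} d (here X≤c) =
    if-does-elim (Insertion v c (insertDesc v p d X)) (v c ≤? v d)
      (λ c≤d → subst (λ Z → Insertion v c Z (d ∷ c ∷ X))
                     (sym (insertDesc-top (All.map (λ e≤c → ≤-trans e≤c c≤d) X≤c)))
                     (there c≤d (here X≤c)))
      (λ c≰d → here (All-insertDesc X (<⇒≤ (≰⇒> c≰d)) X≤c))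
  Insertion-insertDesc {c} d (there {e} c≤e ins) =
    if-does-elim₂ (Insertion v c) (v e ≤? v d)
      (λ e≤d → there (≤-trans c≤e e≤d) (there c≤e ins))
      (λ _ → there c≤e (Insertion-insertDesc d ins))

  Insertion-sortDesc-snoc : ∀ c R →
    Insertion v c (sortDesc v p R) (sortDesc v p (R ++ c ∷ []))
  Insertion-sortDesc-snoc c []      = here []
  Insertion-sortDesc-snoc c (d ∷ R) = Insertion-insertDesc d (Insertion-sortDesc-snoc c R)

  segsum-scale : ∀ k a L → segsum v p (k * a) L ≡ k * segsum v p a L
  segsum-scale k a [] = sym (*-zeroʳ k)
  segsum-scale k a (d ∷ L) = begin
    k * a * p d * v d + segsum v p (k * a * (1ℚ - p d)) L
      ≡⟨ cong (λ b → k * a * p d * v d + segsum v p b L) (*-assoc k a (1ℚ - p d)) ⟩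
    k * a * p d * v d + segsum v p (k * (a * (1ℚ - p d))) L
      ≡⟨ cong (k * a * p d * v d +_) (segsum-scale k (a * (1ℚ - p d)) L) ⟩
    k * a * p d * v d + k * segsum v p (a * (1ℚ - p d)) L
      ≡⟨ solve 5 (λ k a pd vd s → k :* a :* pd :* vd :+ k :* s := k :* (a :* pd :* vd :+ s))
               refl k a (p d) (v d) (segsum v p (a * (1ℚ - p d)) L) ⟩
    k * (a * p d * v d + segsum v p (a * (1ℚ - p d)) L) ∎
    where open ≡-Reasoning

  segvalSum : List (List (Fin n)) → ℚ
  segvalSum = foldr (λ S s → segval v p S + s) 0ℚ

  sumSegvals≡segvalSum : ∀ P → sumSegvals v p P ≡ segvalSum (segments P)
  sumSegvals≡segvalSum P with foldr-universal _ _ _ refl (λ _ _ → refl)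
  ... | universal with segments P
  ... | L = universal L

  pendingSegvals : List (Fin n) → Path n → ℚ
  pendingSegvals R P = sumSegvals v p (rejections R ++ P)

  pendingSegvals-[] : ∀ R → pendingSegvals R [] ≡ segval v p R
  pendingSegvals-[] [] = refl
  pendingSegvals-[] (c ∷ R) = begin
    sumSegvals v p (rejections (c ∷ R) ++ [])
      ≡⟨ cong (sumSegvals v p) (++-identityʳ (rejections (c ∷ R))) ⟩
    sumSegvals v p (rejections (c ∷ R))
      ≡⟨ sumSegvals≡segvalSum (rejections (c ∷ R)) ⟩
    segvalSum (segments (rejections (c ∷ R)))
      ≡⟨ cong segvalSum (segments-rejections c R) ⟩
    segval v p (c ∷ R) + 0ℚ
      ≡⟨ +-identityʳ (segval v p (c ∷ R)) ⟩
    segval v p (c ∷ R) ∎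
    where open ≡-Reasoning

  pendingSegvals-accept : ∀ R c P →
    pendingSegvals R ((c , true) ∷ P) ≡ segval v p (R ++ c ∷ []) + sumSegvals v p P
  pendingSegvals-accept R c P = begin
    sumSegvals v p (rejections R ++ (c , true) ∷ P)
      ≡⟨ sumSegvals≡segvalSum (rejections R ++ (c , true) ∷ P) ⟩
    segvalSum (segments (rejections R ++ (c , true) ∷ P))
      ≡⟨ cong segvalSum (segments-rejections-accept R c P) ⟩
    segval v p (R ++ c ∷ []) + segvalSum (segments P)
      ≡⟨ cong (segval v p (R ++ c ∷ []) +_) (sumSegvals≡segvalSum P) ⟨
    segval v p (R ++ c ∷ []) + sumSegvals v p P ∎
    where open ≡-Reasoning

  pendingSegvals-reject : ∀ R c P →
    pendingSegvals R ((c , false) ∷ P) ≡ pendingSegvals (R ++ c ∷ []) P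
  pendingSegvals-reject R c P = cong (sumSegvals v p) (begin
    rejections R ++ (c , false) ∷ P
      ≡⟨ ++-assoc (rejections R) _ P ⟨
    (rejections R ++ (c , false) ∷ []) ++ P
      ≡⟨ cong (_++ P) (map-++ (_, false) R (c ∷ [])) ⟨
    rejections (R ++ c ∷ []) ++ P ∎)
    where open ≡-Reasoning

  expectM-acceptedValue-node : ∀ c a r →
    expectM p (just (node c a r)) (acceptedValue v p)
      ≡ p c * (v c + expectM p a (acceptedValue v p))
        + (1ℚ - p c) * expectM p r (acceptedValue v p)
  expectM-acceptedValue-node c a r =
    trans (expectM-node p c a r (acceptedValue v p))
          (cong (λ x → p c * x + (1ℚ - p c) * expectM p r (acceptedValue v p))
                (expectM-const+ p a (v c) (acceptedValue v p)))

  expectM-pendingSegvals-node : ∀ R c a r →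
    expectM p (just (node c a r)) (pendingSegvals R)
      ≡ p c * (segval v p (R ++ c ∷ []) + expectM p a (sumSegvals v p))
        + (1ℚ - p c) * expectM p r (pendingSegvals (R ++ c ∷ []))
  expectM-pendingSegvals-node R c a r =
    trans (expectM-node p c a r (pendingSegvals R))
          (cong₂ (λ x y → p c * x + (1ℚ - p c) * y)
                 (trans (weightedSum-cong p (pendingSegvals-accept R c) (pathsM p a))
                        (expectM-const+ p a (segval v p (R ++ c ∷ [])) (sumSegvals v p)))
                 (weightedSum-cong p (pendingSegvals-reject R c) (pathsM p r)))

module _ (v p : Fin n → ℚ) (v≥0 : ∀ i → 0ℚ ≤ v i)
         (p≥0 : ∀ i → 0ℚ ≤ p i) (p≤1 : ∀ i → p i ≤ 1ℚ) where

  private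
    1-p≥0 : ∀ i → 0ℚ ≤ 1ℚ - p i
    1-p≥0 i = p≤q⇒0≤q-p (p≤1 i)

  segsum-nonNeg : ∀ a L → 0ℚ ≤ a → 0ℚ ≤ segsum v p a L
  segsum-nonNeg a []      0≤a = ≤-refl
  segsum-nonNeg a (d ∷ L) 0≤a =
    0≤p+q (0≤p*q (0≤p*q 0≤a (p≥0 d)) (v≥0 d))
          (segsum-nonNeg _ L (0≤p*q 0≤a (1-p≥0 d)))

  segval-nonNeg : ∀ R → 0ℚ ≤ segval v p R
  segval-nonNeg R = segsum-nonNeg 1ℚ (sortDesc v p R) (nonNegative⁻¹ 1ℚ)

  segsum-≤ : ∀ c a L → All (λ e → v e ≤ v c) L → 0ℚ ≤ a →
    segsum v p a L ≤ a * v c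
  segsum-≤ c a []      []           0≤a = 0≤p*q 0≤a (v≥0 c)
  segsum-≤ c a (d ∷ L) (d≤c ∷ L≤c) 0≤a =
    ≤-by-difference (a * p d * (v c - v d) + (a' * v c - segsum v p a' L))
      (solve 5 (λ a pd vc vd s → a :* vc :- (a :* pd :* vd :+ s)
                                 := a :* pd :* (vc :- vd) :+ (a :* (con 1ℚ :- pd) :* vc :- s))
             refl a (p d) (v c) (v d) (segsum v p a' L))
      (0≤p+q (0≤p*q (0≤p*q 0≤a (p≥0 d)) (p≤q⇒0≤q-p d≤c))
             (p≤q⇒0≤q-p (segsum-≤ c a' L L≤c (0≤p*q 0≤a (1-p≥0 d)))))
    where
    a' = a * (1ℚ - p d)

  segsum-Insertion : ∀ {c X Y} → Insertion v c X Y → ∀ a → 0ℚ ≤ a →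
    a * p c * v c + segsum v p a X ≤ (1ℚ + p c) * segsum v p a Y
  segsum-Insertion {c} {X} (here X≤c) a 0≤a =
    ≤-by-difference (p c * p c * (a * v c - s)) difference
      (0≤p*q (0≤p*q (p≥0 c) (p≥0 c)) (p≤q⇒0≤q-p (segsum-≤ c a X X≤c 0≤a)))
    where
    s = segsum v p a X
    difference :
      (1ℚ + p c) * (a * p c * v c + segsum v p (a * (1ℚ - p c)) X) - (a * p c * v c + s)
        ≡ p c * p c * (a * v c - s)
    difference = begin
      (1ℚ + p c) * (a * p c * v c + segsum v p (a * (1ℚ - p c)) X) - (a * p c * v c + s)
        ≡⟨ cong (λ b → (1ℚ + p c) * (a * p c * v c + segsum v p b X) - (a * p c * v c + s))
                (*-comm a (1ℚ - p c)) ⟩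
      (1ℚ + p c) * (a * p c * v c + segsum v p ((1ℚ - p c) * a) X) - (a * p c * v c + s)
        ≡⟨ cong (λ t → (1ℚ + p c) * (a * p c * v c + t) - (a * p c * v c + s))
                (segsum-scale v p (1ℚ - p c) a X) ⟩
      (1ℚ + p c) * (a * p c * v c + (1ℚ - p c) * s) - (a * p c * v c + s)
        ≡⟨ solve 4 (λ pc vc a s → (con 1ℚ :+ pc) :* (a :* pc :* vc :+ (con 1ℚ :- pc) :* s)
                                    :- (a :* pc :* vc :+ s)
                                  := pc :* pc :* (a :* vc :- s))
                 refl (p c) (v c) a s ⟩
      p c * p c * (a * v c - s) ∎
      where open ≡-Reasoning
  segsum-Insertion {c} (there {d} {X} {Y} c≤d ins) a 0≤a =
    ≤-by-difference (a * p c * p d * (v d - v c) + ((1ℚ + p c) * sY - (a' * p c * v c + sX)))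
      (solve 7 (λ a pc vc pd vd sx sy →
                 (con 1ℚ :+ pc) :* (a :* pd :* vd :+ sy)
                   :- (a :* pc :* vc :+ (a :* pd :* vd :+ sx))
                 := a :* pc :* pd :* (vd :- vc)
                    :+ ((con 1ℚ :+ pc) :* sy :- (a :* (con 1ℚ :- pd) :* pc :* vc :+ sx)))
             refl a (p c) (v c) (p d) (v d) sX sY)
      (0≤p+q (0≤p*q (0≤p*q (0≤p*q 0≤a (p≥0 c)) (p≥0 d)) (p≤q⇒0≤q-p c≤d))
             (p≤q⇒0≤q-p (segsum-Insertion ins a' (0≤p*q 0≤a (1-p≥0 d)))))
    where
    a' = a * (1ℚ - p d)
    sX = segsum v p a' X
    sY = segsum v p a' Y

  segval-snoc : ∀ c R → p c * v c + segval v p R ≤ (1ℚ + p c) * segval v p (R ++ c ∷ [])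
  segval-snoc c R =
    subst (λ x → x + segval v p R ≤ (1ℚ + p c) * segval v p (R ++ c ∷ []))
          (cong (_* v c) (*-identityˡ (p c)))
          (segsum-Insertion (Insertion-sortDesc-snoc v p c R) 1ℚ (nonNegative⁻¹ 1ℚ))

  half-value-≤-pendingSegvals : ∀ m R →
    ½ * expectM p m (acceptedValue v p) + ½ * segval v p R
      ≤ expectM p m (pendingSegvals v p R)
  half-value-≤-pendingSegvals nothing R =
    ≤-by-difference (½ * sv)
      (trans (cong (λ x → 1ℚ * x + 0ℚ - (½ * (1ℚ * 0ℚ + 0ℚ) + ½ * sv))
                   (pendingSegvals-[] v p R))
             (solve 1 (λ s → con 1ℚ :* s :+ con 0ℚ
                               :- (con ½ :* (con 1ℚ :* con 0ℚ :+ con 0ℚ) :+ con ½ :* s)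
                             := con ½ :* s)
                    refl sv))
      (0≤p*q (nonNegative⁻¹ ½) (segval-nonNeg R))
    where
    sv = segval v p R
  half-value-≤-pendingSegvals (just (node c a r)) R =
    ≤-by-difference
      (p c * (Ea - (½ * Va + ½ * 0ℚ)) + (1ℚ - p c) * (Er - (½ * Vr + ½ * sv'))
        + ½ * ((1ℚ + p c) * sv' - (p c * v c + sv)))
      (trans (cong₂ (λ x y → x - (½ * y + ½ * sv))
                    (expectM-pendingSegvals-node v p R c a r)
                    (expectM-acceptedValue-node v p c a r))
       (solve 8 (λ pc vc s s' va vr ea er →
                  pc :* (s' :+ ea) :+ (con 1ℚ :- pc) :* er
                    :- (con ½ :* (pc :* (vc :+ va) :+ (con 1ℚ :- pc) :* vr) :+ con ½ :* s)
                  := pc :* (ea :- (con ½ :* va :+ con ½ :* con 0ℚ))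
                     :+ (con 1ℚ :- pc) :* (er :- (con ½ :* vr :+ con ½ :* s'))
                     :+ con ½ :* ((con 1ℚ :+ pc) :* s' :- (pc :* vc :+ s)))
               refl (p c) (v c) sv sv' Va Vr Ea Er))
      (0≤p+q (0≤p+q (0≤p*q (p≥0 c) (p≤q⇒0≤q-p accepted))
                    (0≤p*q (1-p≥0 c) (p≤q⇒0≤q-p rejected)))
             (0≤p*q (nonNegative⁻¹ ½) (p≤q⇒0≤q-p (segval-snoc c R))))
    where
    sv sv' Va Vr Ea Er : ℚ
    sv  = segval v p R
    sv' = segval v p (R ++ c ∷ [])
    Va  = expectM p a (acceptedValue v p)
    Vr  = expectM p r (acceptedValue v p)
    Ea  = expectM p a (sumSegvals v p)
    Er  = expectM p r (pendingSegvals v p (R ++ c ∷ []))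

    accepted : ½ * Va + ½ * 0ℚ ≤ Ea
    accepted = half-value-≤-pendingSegvals a []

    rejected : ½ * Vr + ½ * sv' ≤ Er
    rejected = half-value-≤-pendingSegvals r (R ++ c ∷ [])

lemma1 : (n : ℕ) (v p : Fin n → ℚ) →
         (∀ i → 0ℚ ≤ v i) → (∀ i → 0ℚ ≤ p i) → (∀ i → p i ≤ 1ℚ) →
         (t : Tree n) → DistinctLabels t →
         ½ * val v p t ≤ expect p t (sumSegvals v p)
lemma1 n v p v≥0 p≥0 p≤1 t _ = begin
  ½ * val v p t
    ≡⟨ cong (½ *_) (expect≡weightedSum p t (acceptedValue v p)) ⟩
  ½ * expectM p (just t) (acceptedValue v p)
    ≡⟨ +-identityʳ _ ⟨
  ½ * expectM p (just t) (acceptedValue v p) + 0ℚ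
    ≡⟨ cong (½ * expectM p (just t) (acceptedValue v p) +_) (*-zeroʳ ½) ⟨
  ½ * expectM p (just t) (acceptedValue v p) + ½ * segval v p []
    ≤⟨ half-value-≤-pendingSegvals v p v≥0 p≥0 p≤1 (just t) [] ⟩
  expectM p (just t) (sumSegvals v p)
    ≡⟨ expect≡weightedSum p t (sumSegvals v p) ⟨
  expect p t (sumSegvals v p) ∎
  where open ≤-Reasoning
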